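{- Let $\Phi:(S,\cdot)\to(T,\cdot)$ be a semigroup homomorphism such that $\Phi(S)$ is piecewise syndetic in $T$. If $A\subseteq S$ is quasi-central in $S$, then $\Phi(A)$ is quasi-central in $T$.
   Context: For a semigroup $(X,\cdot)$, $B\subseteq X$ and $x\in X$, let $x^{ -1}B=\{y\in X: x\cdot y\in B\}$; $\mathcal P_f(X)$ denotes the set of finite nonempty subsets of $X$. A set $B\subseteq X$ is piecewise syndetic in $X$ if there exists $G\in\mathcal P_f(X)$ such that for every $F\in\mathcal P_f(X)$ there exists $x\in X$ with $F\cdot x\subseteq\bigcup_{t\in G}t^{ -1}B$. A family $\langle C_F\rangle_{F\in\mathcal I}$ is downward directed if $(\mathcal I,\geq)$ is a directed set and $F\geq G$ implies $C_F\subseteq C_G$. A set $A\subseteq X$ is quasi-central in $X$ if there is a downward directed family $\langle C_F\rangle_{F\in\mathcal I}$ of subsets of $A$ such that (1) for each $F\in\mathcal I$ and each $x\in C_F$ there is $G\in\mathcal I$ with $C_G\subseteq x^{ -1}C_F$, and (2) each $C_F$ is piecewise syndetic in $X$. -}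

module Defs where

open import Level using (Level; _⊔_; suc; 0ℓ)
open import Data.Product using (Σ; ∃; _×_; _,_)
open import Data.List using (List)
open import Data.List.NonEmpty using (List⁺; toList)
open import Data.List.Membership.Propositional using (_∈_)
open import Relation.Binary.PropositionalEquality using (_≡_)

record SemigroupOn (X : Set) : Set where
  field
    _·_   : X → X → X
    assoc : ∀ x y z → ((x · y) · z) ≡ (x · (y · z))

Subset : Set → Set₁
Subset X = X → Set

_⊆_ : {X : Set} → Subset X → Subset X → Set
B ⊆ C = ∀ {x} → B x → C x

-- Finite nonempty subsets of X, represented by nonempty lists.
Pf : Set → Set
Pf X = List⁺ X

module _ {X : Set} (SX : SemigroupOn X) where
  open SemigroupOn SX

  _⁻¹_ : X → Subset X → Subset X
  (x ⁻¹ B) y = B (x · y)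

  PiecewiseSyndetic : Subset X → Set
  PiecewiseSyndetic B =
    Σ (Pf X) λ G → (F : Pf X) → Σ X λ x →
      ∀ {f} → f ∈ toList F → Σ X λ t → (t ∈ toList G) × (t ⁻¹ B) (f · x)

record DirectedSet (I : Set) : Set₁ where
  field
    _≥_      : I → I → Set
    ≥-refl   : ∀ F → F ≥ F
    ≥-trans  : ∀ {F G H} → F ≥ G → G ≥ H → F ≥ H
    inhabited : I
    directed : ∀ F G → Σ I λ H → (H ≥ F) × (H ≥ G)

module _ {X : Set} (SX : SemigroupOn X) where

  QuasiCentral : Subset X → Set₁
  QuasiCentral A =
    Σ Set λ I → Σ (DirectedSet I) λ D → Σ (I → Subset X) λ C →
      let open DirectedSet D in
      (∀ F → C F ⊆ A)
      × (∀ {F G} → F ≥ G → C F ⊆ C G)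
      × (∀ F x → C F x → Σ I λ G → C G ⊆ (_⁻¹_ SX x (C F)))
      × (∀ F → PiecewiseSyndetic SX (C F))

IsHom : {S T : Set} → SemigroupOn S → SemigroupOn T → (S → T) → Set
IsHom SS ST Φ = ∀ x y → Φ (SemigroupOn._·_ SS x y) ≡ SemigroupOn._·_ ST (Φ x) (Φ y)

image : {S T : Set} → (S → T) → Subset S → Subset T
image Φ A t = Σ _ λ s → A s × (Φ s ≡ t)

open import Data.Unit using (⊤)

Whole : (X : Set) → Subset X
Whole X _ = ⊤

module Submission where

-- Let Φ : S → T be a homomorphism with Φ(S) piecewise syndetic in T, and let
-- ⟨C_F⟩_{F∈I} witness that A is quasi-central in S.  We show that the image
-- family ⟨Φ(C_F)⟩_{F∈I}, over the same directed set, witnesses that Φ(A) is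
-- quasi-central in T.  Containment in Φ(A) and downward directedness hold since
-- images are monotone; condition (1) holds because Φ(x⁻¹C) ⊆ Φ(x)⁻¹Φ(C).
-- The real content is condition (2): images of piecewise syndetic sets are
-- piecewise syndetic.  If H witnesses that Φ(S) is piecewise syndetic and G
-- witnesses this for B, then the finite set {Φ(g)·h : g ∈ G, h ∈ H} witnesses it
-- for Φ(B): given F, pick y with each f·y ∈ h_f⁻¹Φ(S), i.e. h_f·f·y = Φ(s_f);
-- then pick x for the finite set {s_f}, so g·s_f·x ∈ B for some g ∈ G, and
-- Φ(g·s_f·x) = (Φ(g)·h_f)·(f·(y·Φ(x))).

open import Defs
open import Function using (_∘_)
open import Data.Product using (Σ; _×_; _,_; proj₁; proj₂)
open import Data.List using (cartesianProductWith)
open import Data.List.NonEmpty using (List⁺; toList; _∷_)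
open import Data.List.Membership.Propositional using (_∈_; mapWith∈)
open import Data.List.Membership.Propositional.Properties using (∈-cartesianProductWith⁺)
open import Data.List.Relation.Unary.Any using (here; there)
open import Data.List.Relation.Unary.Any.Properties using (mapWith∈⁺)
open import Relation.Binary.PropositionalEquality using (_≡_; refl; cong; sym; module ≡-Reasoning)

products⁺ : {A B C : Set} → (A → B → C) → List⁺ A → List⁺ B → List⁺ C
products⁺ f G@(a ∷ _) H@(b ∷ _) = f a b ∷ cartesianProductWith f (toList G) (toList H)

∈-products⁺ : {A B C : Set} (f : A → B → C) (G : List⁺ A) (H : List⁺ B) {a : A} {b : B}
  → a ∈ toList G → b ∈ toList H → f a b ∈ toList (products⁺ f G H)
∈-products⁺ f (_ ∷ _) (_ ∷ _) a∈G b∈H = there (∈-cartesianProductWith⁺ f a∈G b∈H)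

choices⁺ : {A B : Set} (F : List⁺ A) → (∀ {x} → x ∈ toList F → B) → List⁺ B
choices⁺ F@(_ ∷ _) c = c (here refl) ∷ mapWith∈ (toList F) c

∈-choices⁺ : {A B : Set} (F : List⁺ A) (c : ∀ {x} → x ∈ toList F → B) {x : A}
  (x∈F : x ∈ toList F) → c x∈F ∈ toList (choices⁺ F c)
∈-choices⁺ (_ ∷ _) c x∈F = there (mapWith∈⁺ c (_ , x∈F , refl))

module _ {X : Set} (SX : SemigroupOn X) where
  open SemigroupOn SX

  regroup : ∀ a b c d e → a · ((b · (c · d)) · e) ≡ (a · b) · (c · (d · e))
  regroup a b c d e = begin
    a · ((b · (c · d)) · e)  ≡⟨ cong (a ·_) (assoc b (c · d) e) ⟩
    a · (b · ((c · d) · e))  ≡⟨ cong (λ u → a · (b · u)) (assoc c d e) ⟩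
    a · (b · (c · (d · e)))  ≡⟨ sym (assoc a b (c · (d · e))) ⟩
    (a · b) · (c · (d · e))  ∎
    where open ≡-Reasoning

module Images {S T : Set} (SS : SemigroupOn S) (ST : SemigroupOn T) (Φ : S → T)
  (hom : IsHom SS ST Φ) where
  open SemigroupOn SS renaming (_·_ to _∙_)
  open SemigroupOn ST

  image-mono : {B C : Subset S} → B ⊆ C → image Φ B ⊆ image Φ C
  image-mono B⊆C (s , s∈B , refl) = s , B⊆C s∈B , refl

  image-translate : (x : S) (C : Subset S)
    → image Φ (_⁻¹_ SS x C) ⊆ _⁻¹_ ST (Φ x) (image Φ C)
  image-translate x C (z , xz∈C , refl) = x ∙ z , xz∈C , hom x z

  image-of-translate : ∀ g s x h f y → Φ s ≡ h · (f · y)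
    → Φ (g ∙ (s ∙ x)) ≡ (Φ g · h) · (f · (y · Φ x))
  image-of-translate g s x h f y Φs≡hfy = begin
    Φ (g ∙ (s ∙ x))            ≡⟨ hom g (s ∙ x) ⟩
    Φ g · Φ (s ∙ x)            ≡⟨ cong (Φ g ·_) (hom s x) ⟩
    Φ g · (Φ s · Φ x)          ≡⟨ cong (λ u → Φ g · (u · Φ x)) Φs≡hfy ⟩
    Φ g · ((h · (f · y)) · Φ x) ≡⟨ regroup ST (Φ g) h f y (Φ x) ⟩
    (Φ g · h) · (f · (y · Φ x)) ∎
    where open ≡-Reasoning

  image-piecewiseSyndetic : PiecewiseSyndetic ST (image Φ (Whole S))
    → (B : Subset S) → PiecewiseSyndetic SS B → PiecewiseSyndetic ST (image Φ B)
  image-piecewiseSyndetic (H , syndΦ) B (G , syndB) = G·H , shift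
    where
    G·H : Pf T
    G·H = products⁺ (λ g h → Φ g · h) G H

    shift : (F : Pf T) → Σ T λ z → ∀ {f} → f ∈ toList F
      → Σ T λ t → (t ∈ toList G·H) × image Φ B (t · (f · z))
    shift F = y · Φ x , covered
      where
      -- y with each f·y ∈ h_f⁻¹Φ(S); s_f is the chosen preimage of h_f·(f·y).
      y : T
      y = proj₁ (syndΦ F)
      s : ∀ {f} → f ∈ toList F → S
      s f∈F = proj₁ (proj₂ (proj₂ (proj₂ (syndΦ F) f∈F)))
      -- x with each s_f·x ∈ g⁻¹B for some g ∈ G.
      x : S
      x = proj₁ (syndB (choices⁺ F s))

      covered : ∀ {f} → f ∈ toList F
        → Σ T λ t → (t ∈ toList G·H) × image Φ B (t · (f · (y · Φ x)))
      covered {f} f∈F =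
        let h , h∈H , _ , _ , Φs≡hfy = proj₂ (syndΦ F) f∈F
            g , g∈G , gsx∈B = proj₂ (syndB (choices⁺ F s)) (∈-choices⁺ F s f∈F)
        in Φ g · h , ∈-products⁺ _ G H g∈G h∈H ,
           g ∙ (s f∈F ∙ x) , gsx∈B , image-of-translate g (s f∈F) x h f y Φs≡hfy

theorem3p2 : {S T : Set} (SS : SemigroupOn S) (ST : SemigroupOn T) (Φ : S → T)
    → IsHom SS ST Φ
    → PiecewiseSyndetic ST (image Φ (Whole S))
    → (A : Subset S) → QuasiCentral SS A → QuasiCentral ST (image Φ A)
theorem3p2 SS ST Φ hom psΦ A (I , D , C , C⊆A , C-mono , C-translate , C-ps) =
  I , D , (λ F → image Φ (C F)) ,
  (λ F → image-mono (C⊆A F)) ,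
  (λ F≥G → image-mono (C-mono F≥G)) ,
  imageC-translate ,
  (λ F → image-piecewiseSyndetic psΦ (C F) (C-ps F))
  where
  open Images SS ST Φ hom

  imageC-translate : ∀ F t → image Φ (C F) t
    → Σ I λ G → image Φ (C G) ⊆ _⁻¹_ ST t (image Φ (C F))
  imageC-translate F _ (x , x∈C , refl) =
    proj₁ (C-translate F x x∈C) ,
    image-translate x (C F) ∘ image-mono (proj₂ (C-translate F x x∈C))
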